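{- Let $r\ge\max(2,D)$ be an integer and let $\phi:B_r\to B_r+\phi(0)$ be a graph isomorphism onto a subgraph of $\Gamma$. Then for each primary $x\in\mathcal{A}'$ there exists a primary $x'\in\mathcal{A}'$ such that $\phi(rx)-\phi(0)=rx'$; moreover $\phi(tx)-\phi(0)=tx'$ for every integer $t\in[-r,r]$.
   Context: Let $G$ be a free abelian group of finite rank $k\ge1$, identified with $\mathbb{Z}^k$, and $\mathcal{A}\subset G$ a finite generating set with $\mathcal{A}=-\mathcal{A}$, $0\notin\mathcal{A}$. $\Gamma=\mathrm{Cay}(G,\mathcal{A})$ has vertex set $G$ and edges $\{x,x+a\}$, $a\in\mathcal{A}$. $\rho(x)$ is the length of a shortest path in $\Gamma$ from $0$ to $x$, $\omega(x)$ the number of such shortest paths. $B_r$ is the subgraph of $\Gamma$ induced by $\{x:\rho(x)\le r\}$, and $B_r+z$ its translate by $z$. An element $x\in\mathcal{A}$ is primary if $\rho(tx)=t$ and $\omega(tx)=1$ for all integers $t\ge0$, otherwise secondary; $\mathcal{A}'$ is the set of primary elements. $D$ is a fixed positive integer such that every secondary $x\in\mathcal{A}$ satisfies $\rho(Dx)\ne D$ or $\omega(Dx)\ne1$. -}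

module Defs where

open import Data.Nat using (ℕ; zero; suc; _≤_; _<_)
open import Data.Integer as ℤ using (ℤ; +_)
open import Data.Vec using (Vec; []; _∷_; zipWith; map; replicate; head; last)
open import Data.List using (List; length)
import Data.List as List
open import Data.List.Membership.Propositional using (_∈_)
open import Data.Product using (Σ; ∃; _×_; _,_)
open import Data.Unit using (⊤)
open import Relation.Nullary using (¬_)
open import Relation.Binary.PropositionalEquality using (_≡_)

G : ℕ → Set
G k = Vec ℤ k

module _ {k : ℕ} where

  0G : G k
  0G = replicate k (+ 0)

  infixl 6 _⊕_ _⊖_
  _⊕_ : G k → G k → G k
  _⊕_ = zipWith ℤ._+_

  ⊝_ : G k → G k
  ⊝_ = map (λ z → ℤ.- z)

  _⊖_ : G k → G k → G k
  x ⊖ y = x ⊕ (⊝ y)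

  infixl 7 _·_
  _·_ : ℤ → G k → G k
  t · x = map (t ℤ.*_) x

  lincomb : List ℤ → List (G k) → G k
  lincomb (c List.∷ cs) (a List.∷ as) = (c · a) ⊕ lincomb cs as
  lincomb _ _ = 0G

  record IsSymGenSet (A : List (G k)) : Set where
    field
      symmetric : ∀ a → a ∈ A → (⊝ a) ∈ A
      zero∉     : ¬ (0G ∈ A)
      generates : ∀ (x : G k) → ∃ λ (cs : List ℤ) → length cs ≡ length A × lincomb cs A ≡ x

  module Cayley (A : List (G k)) where

    Adj : G k → G k → Set
    Adj u v = (v ⊖ u) ∈ A

    Chain : ∀ {n} → Vec (G k) (suc n) → Set
    Chain (_ ∷ []) = ⊤
    Chain (u ∷ v ∷ vs) = Adj u v × Chain (v ∷ vs)

    IsWalk : ∀ {n} → G k → G k → Vec (G k) (suc n) → Set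
    IsWalk x y vs = head vs ≡ x × last vs ≡ y × Chain vs

    HasWalk : G k → ℕ → Set
    HasWalk x n = Σ (Vec (G k) (suc n)) (IsWalk 0G x)

    ρ≡ : G k → ℕ → Set
    ρ≡ x n = HasWalk x n × (∀ m → m < n → ¬ HasWalk x m)

    -- ω(x) ≡ 1, given ρ(x) ≡ n : exactly one shortest path from 0 to x
    ω≡1 : G k → ℕ → Set
    ω≡1 x n = HasWalk x n ×
              (∀ (vs ws : Vec (G k) (suc n)) → IsWalk 0G x vs → IsWalk 0G x ws → vs ≡ ws)

    Geo1 : G k → ℕ → Set
    Geo1 x n = ρ≡ x n × ω≡1 x n

    Primary : G k → Set
    Primary x = ∀ (t : ℕ) → Geo1 ((+ t) · x) t

    InBall : ℕ → G k → Set
    InBall r x = ∃ λ n → n ≤ r × ρ≡ x n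

    record BallIso (r : ℕ) (φ : G k → G k) : Set where
      field
        into    : ∀ u → InBall r u → InBall r (φ u ⊖ φ 0G)
        inj     : ∀ u v → InBall r u → InBall r v → φ u ≡ φ v → u ≡ v
        onto    : ∀ y → InBall r y → ∃ λ u → InBall r u × φ u ≡ y ⊕ φ 0G
        adj→    : ∀ u v → InBall r u → InBall r v → Adj u v → Adj (φ u) (φ v)
        adj←    : ∀ u v → InBall r u → InBall r v → Adj (φ u) (φ v) → Adj u v

module Submission where

-- Write F u = φ(u) − φ(0).  F fixes 0, maps B_r into B_r, and preserves and
-- reflects adjacency there, so walks from 0 of length ≤ r can be pushed
-- forward and pulled back along F.  The heart of the argument is the
-- midpoint lemma: if a, a + x, a + 2x lie in B_r (one of the two ends strictly
-- inside) then F(a + 2x) − F(a + x) = F(a + x) − F(a).  Indeed the vertex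
-- w = F(a) + F(a + 2x) − F(a + x) is adjacent to F(a) and F(a + 2x); its
-- preimage u gives a second walk 0, u − a, 2x, and uniqueness of the
-- geodesic to 2x forces u = a + x.  Hence the differences
-- Δ(s) = F((s+1)x) − F(sx) are constant, equal to x′ = F(x) ∈ 𝒜, and
-- telescoping gives F(tx) = tx′ for |t| ≤ r.  Finally F transports the
-- unique geodesic to Dx onto one to Dx′, so x′ cannot be secondary by the
-- choice of D; as being primary is a ¬¬-stable property, x′ is primary.

open import Defs
open import Data.Nat as ℕ using (ℕ; zero; suc; _≤_; _<_; z≤n; s≤s; s≤s⁻¹)
open import Data.Nat.Properties
  using (≤-trans; <⇒≤; n<1+n; m<n⇒m<1+n; m<1+n⇒m<n∨m≡n; m+n≤o⇒m≤o; +-suc; +-identityʳ)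
open import Data.Integer as ℤ using (ℤ; +_; -[1+_]; ∣_∣)
import Data.Integer.Properties as ℤP
open import Data.Integer.Tactic.RingSolver using (solve-∀)
open import Data.Vec using (Vec; []; _∷_; head; tail; last; map)
import Data.Vec.Properties as VecP
open import Data.Vec.Relation.Unary.All using (All; []; _∷_)
open import Data.List using (List)
open import Data.List.Membership.Propositional using (_∈_; find; lose)
open import Data.List.Relation.Unary.Any using (any?)
open import Data.Product using (Σ; ∃; _×_; _,_; proj₁; proj₂)
open import Data.Sum using (_⊎_; inj₁; inj₂; [_,_]′)
open import Data.Unit using (tt)
open import Data.Empty using (⊥-elim)
open import Relation.Nullary using (¬_; Dec; yes; no)
open import Relation.Nullary.Decidable using (decidable-stable)
open import Relation.Binary.PropositionalEquality hiding ([_])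

private variable k : ℕ

⊕-comm : (u v : G k) → u ⊕ v ≡ v ⊕ u
⊕-comm []       []       = refl
⊕-comm (u ∷ us) (v ∷ vs) = cong₂ _∷_ (ℤP.+-comm u v) (⊕-comm us vs)

⊕-⊖-cancelˡ : (u a : G k) → (u ⊕ a) ⊖ u ≡ a
⊕-⊖-cancelˡ []       []       = refl
⊕-⊖-cancelˡ (u ∷ us) (a ∷ as) = cong₂ _∷_ (law u a) (⊕-⊖-cancelˡ us as)
  where law : ∀ u a → (u ℤ.+ a) ℤ.+ ℤ.- u ≡ a
        law = solve-∀

⊕-⊖-cancelʳ : (u a : G k) → (u ⊕ a) ⊖ a ≡ u
⊕-⊖-cancelʳ u a = trans (cong (_⊖ a) (⊕-comm u a)) (⊕-⊖-cancelˡ a u)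

⊖-⊕-cancel : (v c : G k) → (v ⊖ c) ⊕ c ≡ v
⊖-⊕-cancel []       []       = refl
⊖-⊕-cancel (v ∷ vs) (c ∷ cs) = cong₂ _∷_ (law v c) (⊖-⊕-cancel vs cs)
  where law : ∀ v c → (v ℤ.+ ℤ.- c) ℤ.+ c ≡ v
        law = solve-∀

⊕-⊖-complete : (u v : G k) → u ⊕ (v ⊖ u) ≡ v
⊕-⊖-complete u v = trans (⊕-comm u (v ⊖ u)) (⊖-⊕-cancel v u)

⊖-self : (u : G k) → u ⊖ u ≡ 0G
⊖-self []       = refl
⊖-self (u ∷ us) = cong₂ _∷_ (ℤP.+-inverseʳ u) (⊖-self us)

⊖-identityʳ : (u : G k) → u ⊖ 0G ≡ u
⊖-identityʳ []       = refl
⊖-identityʳ (u ∷ us) = cong₂ _∷_ (ℤP.+-identityʳ u) (⊖-identityʳ us)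

⊝-⊖ : (u v : G k) → ⊝ (u ⊖ v) ≡ v ⊖ u
⊝-⊖ []       []       = refl
⊝-⊖ (u ∷ us) (v ∷ vs) = cong₂ _∷_ (law u v) (⊝-⊖ us vs)
  where law : ∀ u v → ℤ.- (u ℤ.+ ℤ.- v) ≡ v ℤ.+ ℤ.- u
        law = solve-∀

⊖-translate : (v u c : G k) → (v ⊖ c) ⊖ (u ⊖ c) ≡ v ⊖ u
⊖-translate []       []       []       = refl
⊖-translate (v ∷ vs) (u ∷ us) (c ∷ cs) = cong₂ _∷_ (law v u c) (⊖-translate vs us cs)
  where law : ∀ v u c → (v ℤ.+ ℤ.- c) ℤ.+ ℤ.- (u ℤ.+ ℤ.- c) ≡ v ℤ.+ ℤ.- u
        law = solve-∀

⊖-telescope : (c b a : G k) → c ⊖ a ≡ (c ⊖ b) ⊕ (b ⊖ a)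
⊖-telescope []       []       []       = refl
⊖-telescope (c ∷ cs) (b ∷ bs) (a ∷ as) = cong₂ _∷_ (law c b a) (⊖-telescope cs bs as)
  where law : ∀ c b a → c ℤ.+ ℤ.- a ≡ (c ℤ.+ ℤ.- b) ℤ.+ (b ℤ.+ ℤ.- a)
        law = solve-∀

⊖-parallelogram : (c b a : G k) → c ⊖ (a ⊕ (c ⊖ b)) ≡ b ⊖ a
⊖-parallelogram []       []       []       = refl
⊖-parallelogram (c ∷ cs) (b ∷ bs) (a ∷ as) = cong₂ _∷_ (law c b a) (⊖-parallelogram cs bs as)
  where law : ∀ c b a → c ℤ.+ ℤ.- (a ℤ.+ (c ℤ.+ ℤ.- b)) ≡ b ℤ.+ ℤ.- a
        law = solve-∀

·-zero : (v : G k) → (+ 0) · v ≡ 0G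
·-zero []       = refl
·-zero (v ∷ vs) = cong₂ _∷_ (ℤP.*-zeroˡ v) (·-zero vs)

·-one : (v : G k) → (+ 1) · v ≡ v
·-one []       = refl
·-one (v ∷ vs) = cong₂ _∷_ (ℤP.*-identityˡ v) (·-one vs)

·-suc : (s : ℤ) (v : G k) → (+ 1 ℤ.+ s) · v ≡ s · v ⊕ v
·-suc s []       = refl
·-suc s (v ∷ vs) = cong₂ _∷_ (law s v) (·-suc s vs)
  where law : ∀ s v → (+ 1 ℤ.+ s) ℤ.* v ≡ s ℤ.* v ℤ.+ v
        law = solve-∀

·-neg : (m : ℤ) (v : G k) → (ℤ.- m) · v ≡ m · (⊝ v)
·-neg m []       = refl
·-neg m (v ∷ vs) = cong₂ _∷_ (law m v) (·-neg m vs)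
  where law : ∀ m v → (ℤ.- m) ℤ.* v ≡ m ℤ.* (ℤ.- v)
        law = solve-∀

·-suc-⊖ : (s : ℤ) (v : G k) → (+ 1 ℤ.+ s) · v ⊖ s · v ≡ v
·-suc-⊖ s v = trans (cong (_⊖ s · v) (·-suc s v)) (⊕-⊖-cancelˡ (s · v) v)

·-two : (v : G k) → v ⊕ v ≡ (+ 2) · v
·-two v = trans (cong (_⊕ v) (sym (·-one v))) (sym (·-suc (+ 1) v))

last-map : ∀ {A B : Set} {n} (f : A → B) (xs : Vec A (suc n)) → last (map f xs) ≡ f (last xs)
last-map f (x ∷ [])     = refl
last-map f (x ∷ y ∷ ys) = last-map f (y ∷ ys)

All-last : ∀ {A : Set} {P : A → Set} {n} {xs : Vec A (suc n)} → All P xs → P (last xs)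
All-last (px ∷ [])       = px
All-last (_ ∷ py ∷ pys) = All-last (py ∷ pys)

neg-bound : ∀ r n → ℤ.- (+ r) ℤ.≤ -[1+ n ] → suc n ≤ r
neg-bound zero    n ()
neg-bound (suc r) n (ℤ.-≤- n≤r) = s≤s n≤r

∣1+-[1+n]∣ : ∀ n → ∣ + 1 ℤ.+ -[1+ n ] ∣ ≡ n
∣1+-[1+n]∣ zero    = refl
∣1+-[1+n]∣ (suc n) = refl

module _ {p} {P : ℕ → Set p} (P? : ∀ n → Dec (P n)) where

  least-below : ∀ n → (∀ j → j < n → ¬ P j) ⊎ (∃ λ m → m < n × P m × (∀ j → j < m → ¬ P j))
  least-below zero = inj₁ (λ j ())
  least-below (suc n) with least-below n
  ... | inj₂ (m , m<n , pm , below) = inj₂ (m , m<n⇒m<1+n m<n , pm , below)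
  ... | inj₁ none with P? n
  ...   | yes pn = inj₂ (n , n<1+n n , pn , none)
  ...   | no ¬pn = inj₁ (λ j j<1+n → [ none j , (λ { refl → ¬pn }) ]′ (m<1+n⇒m<n∨m≡n j<1+n))

  least-witness : ∀ {n} → P n → ∃ λ m → m ≤ n × P m × (∀ j → j < m → ¬ P j)
  least-witness {n} pn with least-below (suc n)
  ... | inj₁ none                     = ⊥-elim (none n (n<1+n n) pn)
  ... | inj₂ (m , m<1+n , pm , below) = m , s≤s⁻¹ m<1+n , pm , below

module Walks {k : ℕ} (A : List (G k)) where
  open Cayley A

  _≟G_ : (u v : G k) → Dec (u ≡ v)
  _≟G_ = VecP.≡-dec ℤ._≟_

  data Walk : G k → G k → ℕ → Set where
    done : ∀ {x} → Walk x x 0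
    _◅_  : ∀ {x v y n} → Adj x v → Walk v y n → Walk x y (suc n)

  _▻_ : ∀ {x y z n} → Walk x y n → Adj y z → Walk x z (suc n)
  done     ▻ e = e ◅ done
  (e′ ◅ w) ▻ e = e′ ◅ (w ▻ e)

  vertices : ∀ {x y n} → Walk x y n → Σ (Vec (G k) (suc n)) (IsWalk x y)
  vertices {x} done = (x ∷ []) , refl , refl , tt
  vertices {x} (e ◅ w) with vertices w
  ... | (v ∷ vs) , refl , lst , ch = (x ∷ v ∷ vs) , refl , lst , e , ch

  fromVertices : ∀ {x y n} (vs : Vec (G k) (suc n)) → IsWalk x y vs → Walk x y n
  fromVertices (v ∷ [])     (refl , refl , _)     = done
  fromVertices (u ∷ v ∷ vs) (refl , lst , e , ch) = e ◅ fromVertices (v ∷ vs) (refl , lst , ch)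

  walk? : ∀ n x y → Dec (Walk x y n)
  walk? zero x y with x ≟G y
  ... | yes refl = yes done
  ... | no x≢y   = no λ { done → x≢y refl }
  walk? (suc n) x y with any? (λ a → walk? n (x ⊕ a) y) A
  ... | yes found = let a , a∈A , w = find found in
                    yes (subst (_∈ A) (sym (⊕-⊖-cancelˡ x a)) a∈A ◅ w)
  ... | no none   = no λ { (e ◅ w) →
                      none (lose e (subst (λ v → Walk v y n) (sym (⊕-⊖-complete x _)) w)) }

  hasWalk? : ∀ y n → Dec (HasWalk y n)
  hasWalk? y n with walk? n 0G y
  ... | yes w  = yes (vertices w)
  ... | no ¬w  = no λ (vs , iw) → ¬w (fromVertices vs iw)

  walk⇒InBall : ∀ {r y n} → Walk 0G y n → n ≤ r → InBall r y
  walk⇒InBall {y = y} w n≤r with least-witness (hasWalk? y) (vertices w)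
  ... | m , m≤n , hw , below = m , ≤-trans m≤n n≤r , hw , below

  -- Every vertex of a walk from 0 of length ≤ r lies in B_r; the walk is
  -- given as a prefix of length j followed by a chain of length m.
  chain-in-ball : ∀ {r j m} (vs : Vec (G k) (suc m)) → Walk 0G (head vs) j → Chain vs →
                  j ℕ.+ m ≤ r → All (InBall r) vs
  chain-in-ball {r} {j} (v ∷ []) w _ le = walk⇒InBall w (subst (_≤ r) (+-identityʳ j) le) ∷ []
  chain-in-ball {r} {j} {suc m} (v ∷ v′ ∷ vs) w (e , ch) le =
    walk⇒InBall w (m+n≤o⇒m≤o j le) ∷ chain-in-ball (v′ ∷ vs) (w ▻ e) ch (subst (_≤ r) (+-suc j m) le)

  Adj-sym : (∀ a → a ∈ A → (⊝ a) ∈ A) → ∀ {u v} → Adj u v → Adj v u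
  Adj-sym symmetric {u} {v} e = subst (_∈ A) (⊝-⊖ v u) (symmetric _ e)

  walk-multiple : ∀ {a} → a ∈ A → ∀ n → Walk 0G ((+ n) · a) n
  walk-multiple {a} a∈A zero    = subst (λ z → Walk 0G z 0) (sym (·-zero a)) done
  walk-multiple {a} a∈A (suc n) =
    walk-multiple a∈A n ▻ subst (_∈ A) (sym (·-suc-⊖ (+ n) a)) a∈A

  walk-integer-multiple : (∀ a → a ∈ A → (⊝ a) ∈ A) → ∀ {a} → a ∈ A → ∀ t → Walk 0G (t · a) ∣ t ∣
  walk-integer-multiple symmetric a∈A (+ n)    = walk-multiple a∈A n
  walk-integer-multiple symmetric {a} a∈A -[1+ n ] =
    subst (λ z → Walk 0G z (suc n)) (sym (·-neg (+ suc n) a)) (walk-multiple (symmetric a a∈A) (suc n))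

  -- Being primary is ¬¬-stable for generators: the walks exist outright,
  -- and the remaining clauses are negations or decidable equalities.
  primary-stable : ∀ {a} → a ∈ A → ¬ ¬ Primary a → Primary a
  primary-stable a∈A ¬¬prim t =
      (walk , λ m m<t hw → ¬¬prim λ prim → proj₂ (proj₁ (prim t)) m m<t hw)
    , (walk , λ vs ws iv iw → decidable-stable (VecP.≡-dec _≟G_ vs ws)
                                 λ vs≢ws → ¬¬prim λ prim → vs≢ws (proj₂ (proj₂ (prim t)) vs ws iv iw))
    where walk : HasWalk ((+ t) · _) t
          walk = vertices (walk-multiple a∈A t)

module OnBall {k : ℕ} (A : List (G k)) (symmetric : ∀ a → a ∈ A → (⊝ a) ∈ A)
              (r : ℕ) (φ : G k → G k) (iso : Cayley.BallIso A r φ) where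
  open Cayley A
  open Walks A
  open Cayley.BallIso iso

  F : G k → G k
  F u = φ u ⊖ φ 0G

  F-0 : F 0G ≡ 0G
  F-0 = ⊖-self (φ 0G)

  ball-0 : InBall r 0G
  ball-0 = walk⇒InBall done z≤n

  F-adj : ∀ {u v} → InBall r u → InBall r v → Adj u v → Adj (F u) (F v)
  F-adj {u} {v} bu bv e = subst (_∈ A) (sym (⊖-translate (φ v) (φ u) (φ 0G))) (adj→ u v bu bv e)

  F-adj⁻¹ : ∀ {u v} → InBall r u → InBall r v → Adj (F u) (F v) → Adj u v
  F-adj⁻¹ {u} {v} bu bv e = adj← u v bu bv (subst (_∈ A) (⊖-translate (φ v) (φ u) (φ 0G)) e)

  F-onto : ∀ {y} → InBall r y → ∃ λ u → InBall r u × F u ≡ y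
  F-onto {y} by with onto y by
  ... | u , bu , φu≡ = u , bu , trans (cong (_⊖ φ 0G) φu≡) (⊕-⊖-cancelʳ y (φ 0G))

  F-inj : ∀ {u v} → InBall r u → InBall r v → F u ≡ F v → u ≡ v
  F-inj {u} {v} bu bv Fu≡Fv = inj u v bu bv (begin
    φ u                ≡⟨ sym (⊖-⊕-cancel (φ u) (φ 0G)) ⟩
    F u ⊕ φ 0G         ≡⟨ cong (_⊕ φ 0G) Fu≡Fv ⟩
    F v ⊕ φ 0G         ≡⟨ ⊖-⊕-cancel (φ v) (φ 0G) ⟩
    φ v                ∎)
    where open ≡-Reasoning

  push-chain : ∀ {m} (vs : Vec (G k) (suc m)) → All (InBall r) vs → Chain vs → Chain (map F vs)
  push-chain (v ∷ [])      _                _        = tt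
  push-chain (v ∷ v′ ∷ vs) (bv ∷ bv′ ∷ bvs) (e , ch) =
    F-adj bv bv′ e , push-chain (v′ ∷ vs) (bv′ ∷ bvs) ch

  pull-chain : ∀ {m} (vs : Vec (G k) (suc m)) → All (InBall r) vs → Chain vs →
               ∀ {u} → InBall r u → F u ≡ head vs →
               Σ (Vec (G k) (suc m)) λ us → head us ≡ u × All (InBall r) us × Chain us × map F us ≡ vs
  pull-chain (v ∷ []) _ _ {u} bu Fu≡v = (u ∷ []) , refl , bu ∷ [] , tt , cong (_∷ []) Fu≡v
  pull-chain (v ∷ v′ ∷ vs) (_ ∷ bv′ ∷ bvs) (e , ch) {u} bu Fu≡v with F-onto bv′
  ... | u′ , bu′ , Fu′≡v′ with pull-chain (v′ ∷ vs) (bv′ ∷ bvs) ch bu′ Fu′≡v′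
  ... | (.u′ ∷ us) , refl , bus , ch′ , Fus≡ =
    (u ∷ u′ ∷ us) , refl , bu ∷ bus ,
    (F-adj⁻¹ bu bu′ (subst₂ Adj (sym Fu≡v) (sym Fu′≡v′) e) , ch′) , cong₂ _∷_ Fu≡v Fus≡

  push-walk : ∀ {m y} {vs : Vec (G k) (suc m)} → IsWalk 0G y vs → m ≤ r → IsWalk 0G (F y) (map F vs)
  push-walk {vs = v ∷ vs} (refl , refl , ch) m≤r =
    F-0 , last-map F (v ∷ vs) , push-chain (v ∷ vs) (chain-in-ball (v ∷ vs) done ch m≤r) ch

  F-walk : ∀ {n y} → Walk 0G y n → n ≤ r → Walk 0G (F y) n
  F-walk w n≤r = let vs , iw = vertices w in fromVertices (map F vs) (push-walk iw n≤r)

  pull-walk : ∀ {m y y′} (vs : Vec (G k) (suc m)) → IsWalk 0G y vs → m ≤ r →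
              InBall r y′ → F y′ ≡ y → Σ (Vec (G k) (suc m)) λ us → IsWalk 0G y′ us × map F us ≡ vs
  pull-walk vs (hd , lst , ch) m≤r by′ Fy′≡y
    with pull-chain vs (chain-in-ball vs (subst (λ z → Walk 0G z 0) (sym hd) done) ch m≤r) ch ball-0 (trans F-0 (sym hd))
  ... | us , hu , bus , chu , Fus≡vs = us , (hu , F-inj (All-last bus) by′ Flast≡ , chu) , Fus≡vs
    where Flast≡ : F (last us) ≡ F _
          Flast≡ = trans (sym (last-map F us)) (trans (cong last Fus≡vs) (trans lst (sym Fy′≡y)))

  geo-transfer : ∀ {y n} → InBall r y → n ≤ r → Geo1 y n → Geo1 (F y) n
  geo-transfer {y} {n} by n≤r ((hw , shortest) , (_ , unique)) = (hw′ , shorter) , (hw′ , unique′)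
    where
      hw′ : HasWalk (F y) n
      hw′ = map F (proj₁ hw) , push-walk (proj₂ hw) n≤r

      shorter : ∀ m → m < n → ¬ HasWalk (F y) m
      shorter m m<n (vs , iw) =
        let us , iu , _ = pull-walk vs iw (≤-trans (<⇒≤ m<n) n≤r) by refl in shortest m m<n (us , iu)

      unique′ : ∀ vs ws → IsWalk 0G (F y) vs → IsWalk 0G (F y) ws → vs ≡ ws
      unique′ vs ws iv iw =
        let us , iu , Fus≡vs = pull-walk vs iv n≤r by refl
            us′ , iu′ , Fus′≡ws = pull-walk ws iw n≤r by refl
        in trans (sym Fus≡vs) (trans (cong (map F) (unique us us′ iu iu′)) Fus′≡ws)

  module Along (x : G k) (x∈A : x ∈ A) (primx : Primary x) (2≤r : 2 ≤ r) where

    detour : ∀ {a v c} → Adj a v → Adj v c → IsWalk 0G (c ⊖ a) (0G ∷ (v ⊖ a) ∷ (c ⊖ a) ∷ [])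
    detour {a} {v} {c} a→v v→c =
      refl , refl , subst (_∈ A) (sym (⊖-identityʳ (v ⊖ a))) a→v ,
      subst (_∈ A) (sym (⊖-translate c v a)) v→c , tt

    -- The unique geodesic 0, x, 2x: a vertex between a and a + 2x is a + x.
    middle-unique : ∀ {a b c u} → b ⊖ a ≡ x → c ⊖ b ≡ x → Adj a u → Adj u c → u ≡ b
    middle-unique {a} {b} {c} {u} b-a c-b a→u u→c = begin
      u                ≡⟨ sym (⊕-⊖-complete a u) ⟩
      a ⊕ (u ⊖ a)      ≡⟨ cong (λ vs → a ⊕ head (tail vs)) (unique₂ _ _ (via a→u u→c) (via a→b b→c)) ⟩
      a ⊕ (b ⊖ a)      ≡⟨ ⊕-⊖-complete a b ⟩
      b                ∎
      where
        open ≡-Reasoning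
        unique₂ : ∀ vs ws → IsWalk 0G ((+ 2) · x) vs → IsWalk 0G ((+ 2) · x) ws → vs ≡ ws
        unique₂ = proj₂ (proj₂ (primx 2))
        c-a≡2x : c ⊖ a ≡ (+ 2) · x
        c-a≡2x = trans (⊖-telescope c b a) (trans (cong₂ _⊕_ c-b b-a) (·-two x))
        a→b : Adj a b
        a→b = subst (_∈ A) (sym b-a) x∈A
        b→c : Adj b c
        b→c = subst (_∈ A) (sym c-b) x∈A
        via : ∀ {v} → Adj a v → Adj v c → IsWalk 0G ((+ 2) · x) (0G ∷ (v ⊖ a) ∷ (c ⊖ a) ∷ [])
        via a→v v→c = let hd , lst , ch = detour a→v v→c in hd , trans lst c-a≡2x , ch

    midpoint : ∀ {a b c} → InBall r a → InBall r b → InBall r c → b ⊖ a ≡ x → c ⊖ b ≡ x →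
               (∃ λ j → j < r × (Walk 0G a j ⊎ Walk 0G c j)) → F c ⊖ F b ≡ F b ⊖ F a
    midpoint {a} {b} {c} ba bb bc b-a c-b (j , j<r , near) = begin
      F c ⊖ F b      ≡⟨ sym (⊕-⊖-cancelˡ (F a) (F c ⊖ F b)) ⟩
      w ⊖ F a        ≡⟨ cong (_⊖ F a) (trans (sym Fu≡w) (cong F u≡b)) ⟩
      F b ⊖ F a      ∎
      where
        open ≡-Reasoning
        w : G k
        w = F a ⊕ (F c ⊖ F b)
        Fa→w : Adj (F a) w
        Fa→w = subst (_∈ A) (sym (⊕-⊖-cancelˡ (F a) _)) (F-adj bb bc (subst (_∈ A) (sym c-b) x∈A))
        w→Fc : Adj w (F c)
        w→Fc = subst (_∈ A) (sym (⊖-parallelogram (F c) (F b) (F a))) (F-adj ba bb (subst (_∈ A) (sym b-a) x∈A))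
        w-in-ball : InBall r w
        w-in-ball = walk⇒InBall ([ (λ wa → F-walk wa (<⇒≤ j<r) ▻ Fa→w)
                                 , (λ wc → F-walk wc (<⇒≤ j<r) ▻ Adj-sym symmetric w→Fc) ]′ near) j<r
        preimage : ∃ λ u → InBall r u × F u ≡ w
        preimage = F-onto w-in-ball
        u : G k
        u = proj₁ preimage
        bu : InBall r u
        bu = proj₁ (proj₂ preimage)
        Fu≡w : F u ≡ w
        Fu≡w = proj₂ (proj₂ preimage)
        u≡b : u ≡ b
        u≡b = middle-unique b-a c-b
                (F-adj⁻¹ ba bu (subst (Adj (F a)) (sym Fu≡w) Fa→w))
                (F-adj⁻¹ bu bc (subst (λ z → Adj z (F c)) (sym Fu≡w) w→Fc))

    ball-multiple : ∀ t → ∣ t ∣ ≤ r → InBall r (t · x)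
    ball-multiple t le = walk⇒InBall (walk-integer-multiple symmetric x∈A t) le

    Δ : ℤ → G k
    Δ s = F ((+ 1 ℤ.+ s) · x) ⊖ F (s · x)

    Δ-step : ∀ s → ∣ s ∣ ≤ r → ∣ + 1 ℤ.+ s ∣ ≤ r → ∣ + 1 ℤ.+ (+ 1 ℤ.+ s) ∣ ≤ r →
             ∣ s ∣ < r ⊎ ∣ + 1 ℤ.+ (+ 1 ℤ.+ s) ∣ < r → Δ (+ 1 ℤ.+ s) ≡ Δ s
    Δ-step s b₀ b₁ b₂ near =
      midpoint (ball-multiple s b₀) (ball-multiple (+ 1 ℤ.+ s) b₁) (ball-multiple (+ 1 ℤ.+ (+ 1 ℤ.+ s)) b₂)
               (·-suc-⊖ s x) (·-suc-⊖ (+ 1 ℤ.+ s) x)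
               ([ (λ lt → _ , lt , inj₁ (walk-integer-multiple symmetric x∈A s))
                , (λ lt → _ , lt , inj₂ (walk-integer-multiple symmetric x∈A (+ 1 ℤ.+ (+ 1 ℤ.+ s)))) ]′ near)

    x′ : G k
    x′ = Δ (+ 0)

    Δ-up : ∀ n → suc n ≤ r → Δ (+ n) ≡ x′
    Δ-up zero    _  = refl
    Δ-up (suc n) le = trans (Δ-step (+ n) (<⇒≤ n<r) n<r le (inj₁ n<r)) (Δ-up n n<r)
      where n<r : n < r
            n<r = <⇒≤ le

    Δ-down : ∀ n → suc n ≤ r → Δ -[1+ n ] ≡ x′
    Δ-down zero    le = sym (Δ-step -[1+ 0 ] le z≤n le (inj₂ 2≤r))
    Δ-down (suc n) le =
      trans (sym (Δ-step -[1+ suc n ] le n<r (subst (_≤ r) (sym (∣1+-[1+n]∣ n)) (<⇒≤ n<r))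
                         (inj₂ (subst (_< r) (sym (∣1+-[1+n]∣ n)) n<r))))
            (Δ-down n n<r)
      where n<r : n < r
            n<r = <⇒≤ le

    x′∈A : x′ ∈ A
    x′∈A = F-adj (ball-multiple (+ 0) z≤n) (ball-multiple (+ 1) (<⇒≤ 2≤r))
                 (subst (_∈ A) (sym (·-suc-⊖ (+ 0) x)) x∈A)

    extend-up : ∀ s → Δ s ≡ x′ → F (s · x) ≡ s · x′ → F ((+ 1 ℤ.+ s) · x) ≡ (+ 1 ℤ.+ s) · x′
    extend-up s Δs≡x′ Fs≡ = begin
      F ((+ 1 ℤ.+ s) · x)   ≡⟨ sym (⊕-⊖-complete (F (s · x)) _) ⟩
      F (s · x) ⊕ Δ s       ≡⟨ cong₂ _⊕_ Fs≡ Δs≡x′ ⟩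
      s · x′ ⊕ x′           ≡⟨ sym (·-suc s x′) ⟩
      (+ 1 ℤ.+ s) · x′      ∎
      where open ≡-Reasoning

    extend-down : ∀ s → Δ s ≡ x′ → F ((+ 1 ℤ.+ s) · x) ≡ (+ 1 ℤ.+ s) · x′ → F (s · x) ≡ s · x′
    extend-down s Δs≡x′ Fs+1≡ = begin
      F (s · x)                    ≡⟨ sym (⊕-⊖-cancelʳ (F (s · x)) (Δ s)) ⟩
      (F (s · x) ⊕ Δ s) ⊖ Δ s      ≡⟨ cong₂ _⊖_ (⊕-⊖-complete (F (s · x)) _) Δs≡x′ ⟩
      F ((+ 1 ℤ.+ s) · x) ⊖ x′     ≡⟨ cong (_⊖ x′) (trans Fs+1≡ (·-suc s x′)) ⟩
      (s · x′ ⊕ x′) ⊖ x′           ≡⟨ ⊕-⊖-cancelʳ (s · x′) x′ ⟩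
      s · x′                       ∎
      where open ≡-Reasoning

    linear-up : ∀ n → n ≤ r → F ((+ n) · x) ≡ (+ n) · x′
    linear-up zero    _  = trans (cong F (·-zero x)) (trans F-0 (sym (·-zero x′)))
    linear-up (suc n) le = extend-up (+ n) (Δ-up n le) (linear-up n (<⇒≤ le))

    linear-down : ∀ n → suc n ≤ r → F (-[1+ n ] · x) ≡ -[1+ n ] · x′
    linear-down zero    le = extend-down -[1+ 0 ] (Δ-down 0 le) (linear-up 0 z≤n)
    linear-down (suc n) le = extend-down -[1+ suc n ] (Δ-down (suc n) le) (linear-down n (<⇒≤ le))

    F-linear : ∀ t → ℤ.- (+ r) ℤ.≤ t → t ℤ.≤ + r → F (t · x) ≡ t · x′
    F-linear (+ n)    _  (ℤ.+≤+ n≤r) = linear-up n n≤r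
    F-linear -[1+ n ] lo _           = linear-down n (neg-bound r n lo)

    -- By the choice of D, x′ is primary: F carries the unique geodesic to Dx
    -- onto one to Dx′, which a secondary generator cannot have.
    x′-primary : (D : ℕ) → D ≤ r → (∀ z → z ∈ A → ¬ Primary z → ¬ Geo1 ((+ D) · z) D) → Primary x′
    x′-primary D D≤r secondary⇒¬geo = primary-stable x′∈A λ ¬prim → secondary⇒¬geo x′ x′∈A ¬prim geo-Dx′
      where
        geo-Dx′ : Geo1 ((+ D) · x′) D
        geo-Dx′ = subst (λ z → Geo1 z D) (F-linear (+ D) ℤP.neg-≤-pos (ℤ.+≤+ D≤r))
                        (geo-transfer (ball-multiple (+ D) D≤r) D≤r (primx D))

proposition7 : (k : ℕ) → 1 ≤ k → (A : List (G k)) → IsSymGenSet A →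
    (D : ℕ) → 1 ≤ D →
    (∀ x → x ∈ A → ¬ Cayley.Primary A x → ¬ Cayley.Geo1 A ((+ D) · x) D) →
    (r : ℕ) → 2 ≤ r → D ≤ r →
    (φ : G k → G k) → Cayley.BallIso A r φ →
    ∀ x → x ∈ A → Cayley.Primary A x →
    ∃ λ x′ → x′ ∈ A × Cayley.Primary A x′ ×
      (φ ((+ r) · x) ⊖ φ 0G ≡ (+ r) · x′) ×
      (∀ (t : ℤ) → ℤ.-_ (+ r) ℤ.≤ t → t ℤ.≤ + r → φ (t · x) ⊖ φ 0G ≡ t · x′)
proposition7 k _ A generating D _ secondary⇒¬geo r 2≤r D≤r φ iso x x∈A primx =
  x′ , x′∈A , x′-primary D D≤r secondary⇒¬geo , F-linear (+ r) ℤP.neg-≤-pos ℤP.≤-refl , F-linear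
  where
    open IsSymGenSet generating using (symmetric)
    open OnBall A symmetric r φ iso
    open Along x x∈A primx 2≤r
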